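{- Let $\mathbb X$ be a degenerate gene of length $f\ge2$. Then $\mathcal W(\mathbb X)$ is not empty if and only if $\mathbb X$ is viable.
   Context: A gene of length $f$ is a $2f$-periodic sequence $\mathbb{X}=(X_i)_{i\in\mathbb{Z}}$ with values in the set of symbols $\{\mathbf{A},\mathbf{B},\mathbf{AB},\mathbf{0}\}$ such that: (i) if $X_i=\mathbf{AB}$ then $X_{i+1}=\mathbf{0}$; (ii) if $X_i=\mathbf{0}$ then $X_{i-1}\in\{\mathbf{AB},\mathbf{0}\}$; (iii) there exists $i$ with $X_i=\mathbf{0}$ or $X_i\neq X_{i+f}$. It is degenerate if $X_i\ne\mathbf 0$ for all $i$ (then all $X_i\in\{\mathbf A,\mathbf B\}$). It is viable if there is no $i$ with $X_i=X_{i+f}=\mathbf 0$. Combinatorial weights of a degenerate gene. For a set $W$ of tuples and $c\in\{0,1\}$, $W\times\{c\}$ is the set of tuples obtained by appending $c$. For $\square,\square'\in\{(b,b),(a,b),(b,a)\}$ define $W_i^{\square,\square'}\subset\{0,1\}^{i+1}$ for $-1\le i\le f-1$ by $W_{ -1}^{\square,\square'}=\{()\}$ (the set containing the empty tuple) if $\square=\square'$ and $\emptyset$ otherwise, and for $0\le i\le f-1$: $W_i^{\square,(b,b)}=(W_{i-1}^{\square,(a,b)}\cup W_{i-1}^{\square,(b,a)})\times\{1\}$ if $X_{i-1}=X_{i-1+f}$, else $W_{i-1}^{\square,(b,b)}\times\{1\}$; $W_i^{\square,(a,b)}=W_{i-1}^{\square,(a,b)}\times\{0\}$ if $X_i=X_{i-1}$,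 else $(W_{i-1}^{\square,(b,a)}\cup W_{i-1}^{\square,(b,b)})\times\{0\}$; $W_i^{\square,(b,a)}=W_{i-1}^{\square,(b,a)}\times\{0\}$ if $X_{i+f}=X_{i-1+f}$, else $(W_{i-1}^{\square,(a,b)}\cup W_{i-1}^{\square,(b,b)})\times\{0\}$ (indices of $X$ read modulo $2f$). Then $\mathcal W(\mathbb X)=W_{f-1}^{(b,b),(b,b)}\cup W_{f-1}^{(a,b),(b,a)}\cup W_{f-1}^{(b,a),(a,b)}\subset\{0,1\}^f$. -}

module Defs where

open import Data.Nat using (ℕ; zero; suc)
open import Data.Integer using (ℤ; +_; _+_; _-_; _*_)
open import Data.Bool using (Bool; true; false; if_then_else_)
open import Data.Vec using (Vec; []; _∷ʳ_)
open import Data.List using (List; []; _∷_; _++_; map)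
open import Data.List.Membership.Propositional using (_∈_)
open import Data.Product using (Σ; ∃; _×_; _,_)
open import Data.Sum using (_⊎_)
open import Relation.Nullary using (¬_; Dec; yes; no; does)
open import Relation.Binary.PropositionalEquality using (_≡_; _≢_; refl)

data Symbol : Set where
  A B AB O : Symbol

_≟S_ : (x y : Symbol) → Dec (x ≡ y)
A  ≟S A  = yes refl
A  ≟S B  = no λ ()
A  ≟S AB = no λ ()
A  ≟S O  = no λ ()
B  ≟S A  = no λ ()
B  ≟S B  = yes refl
B  ≟S AB = no λ ()
B  ≟S O  = no λ ()
AB ≟S A  = no λ ()
AB ≟S B  = no λ ()
AB ≟S AB = yes refl
AB ≟S O  = no λ ()
O  ≟S A  = no λ ()
O  ≟S B  = no λ ()
O  ≟S AB = no λ ()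
O  ≟S O  = yes refl

_==_ : Symbol → Symbol → Bool
x == y = does (x ≟S y)

record IsGene (f : ℕ) (X : ℤ → Symbol) : Set where
  field
    periodic : ∀ i → X (i + + 2 * + f) ≡ X i
    condAB   : ∀ i → X i ≡ AB → X (i + + 1) ≡ O
    cond0    : ∀ i → X i ≡ O → (X (i - + 1) ≡ AB ⊎ X (i - + 1) ≡ O)
    nontriv  : ∃ λ i → X i ≡ O ⊎ X i ≢ X (i + + f)

Degenerate : (ℤ → Symbol) → Set
Degenerate X = ∀ i → X i ≢ O

Viable : ℕ → (ℤ → Symbol) → Set
Viable f X = ¬ (∃ λ i → X i ≡ O × X (i + + f) ≡ O)

data Box : Set where
  bb ab ba : Box

_≟B_ : (x y : Box) → Dec (x ≡ y)
bb ≟B bb = yes refl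
bb ≟B ab = no λ ()
bb ≟B ba = no λ ()
ab ≟B bb = no λ ()
ab ≟B ab = yes refl
ab ≟B ba = no λ ()
ba ≟B bb = no λ ()
ba ≟B ab = no λ ()
ba ≟B ba = yes refl

-- W f X n s s' is the finite set W_{n-1}^{s,s'} ⊆ {0,1}^n (0 = false, 1 = true),
-- represented as a list of its elements; n = i+1 ranges over 0..f.
W : (f : ℕ) → (ℤ → Symbol) → (n : ℕ) → Box → Box → List (Vec Bool n)
W f X zero s s' = if does (s ≟B s') then ([] ∷ []) else []
W f X (suc n) s bb =
  map (_∷ʳ true)
    (if X (i - + 1) == X (i - + 1 + + f)
       then W f X n s ab ++ W f X n s ba
       else W f X n s bb)
  where i = + n
W f X (suc n) s ab =
  map (_∷ʳ false)
    (if X i == X (i - + 1)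
       then W f X n s ab
       else W f X n s ba ++ W f X n s bb)
  where i = + n
W f X (suc n) s ba =
  map (_∷ʳ false)
    (if X (i + + f) == X (i - + 1 + + f)
       then W f X n s ba
       else W f X n s ab ++ W f X n s bb)
  where i = + n

𝒲 : (f : ℕ) → (ℤ → Symbol) → List (Vec Bool f)
𝒲 f X = W f X f bb bb ++ W f X f ab ba ++ W f X f ba ab

NonEmpty : ∀ {n} → List (Vec Bool n) → Set
NonEmpty L = ∃ λ w → w ∈ L

-- In a degenerate gene X takes only the values A and B, so viability is automatic and the
-- content is that 𝒲(X) ≠ ∅.  Membership of a box in W_{n-1}^{s,·} evolves by a boolean
-- recurrence driven only by the pairs (X_{n-1}, X_{n-1+f}) and (X_n, X_{n+f}), so the data
-- relevant to 𝒲 after n steps is one of finitely many configurations.  The configurations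
-- reachable with letters in {A, B} are enumerated once and for all; in each of them, once
-- the current pair is the swap of the starting pair and some X_j ≠ X_{j+f} has been seen
-- (which is the situation at n = f by 2f-periodicity and condition (iii)), one of the three
-- sets making up 𝒲 is nonempty.
module Submission where

open import Defs
open import Data.Nat using (ℕ; _≤_)
open import Data.Integer using (ℤ)
open import Function.Bundles using (_⇔_)

open import Data.Nat using (zero; suc; _<_; NonZero)
open import Data.Nat.Properties using (m<1+n⇒m<n∨m≡n)
open import Data.Integer using (+_; -[1+_]; _+_; _-_; _*_; -_)
open import Data.Integer.DivMod using (_%ℕ_; _/ℕ_; a≡a%ℕn+[a/ℕn]*n; n%ℕd<d)
open import Data.Integer.Tactic.RingSolver using (solve-∀)
open import Data.Bool using (Bool; true; false; T; _∧_; _∨_; not; if_then_else_)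
open import Data.Bool.Properties using (T-∨; T-∧; T?) renaming (_≟_ to _≟Bool_)
open import Data.Vec using (Vec; []; _∷ʳ_)
open import Data.List using (List; []; _∷_; _++_; map; concatMap; deduplicate; cartesianProduct)
open import Data.List.Membership.Propositional using (_∈_)
open import Data.List.Membership.Propositional.Properties
  using (∈-++⁺ˡ; ∈-++⁺ʳ; ∈-map⁺; ∈-cartesianProduct⁺)
import Data.List.Membership.DecPropositional as DecMembership
open import Data.List.Relation.Unary.All using (All; all?; lookup)
open import Data.List.Relation.Unary.Any using (here; there)
open import Data.Product using (∃; _×_; _,_)
open import Data.Product.Properties using (≡-dec)
open import Data.Sum using (inj₁; inj₂; [_,_])
open import Data.Empty using (⊥-elim)
open import Relation.Nullary using (Dec; yes; no; does; _×-dec_)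
open import Relation.Nullary.Decidable using (from-yes; map′)
open import Relation.Binary.Definitions using (DecidableEquality)
open import Relation.Binary.PropositionalEquality using (_≡_; _≢_; refl; sym; trans; cong; subst)
open import Function using (_∘_)
open import Function.Bundles using (mk⇔; Equivalence)

==-reflexive : ∀ {x y} → x ≡ y → T (x == y)
==-reflexive {A} refl = _
==-reflexive {B} refl = _
==-reflexive {AB} refl = _
==-reflexive {O} refl = _

≢⇒not-== : ∀ {x y} → x ≢ y → T (not (x == y))
≢⇒not-== {x} {y} x≢y with x ≟S y
... | yes x≡y = x≢y x≡y
... | no _ = _

nonEmpty-map : ∀ {n} {c : Bool} {L : List (Vec Bool n)} → NonEmpty L → NonEmpty (map (_∷ʳ c) L)
nonEmpty-map (w , w∈L) = _ , ∈-map⁺ _ w∈L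

nonEmpty-++ : ∀ {n} {u v : Bool} {L₁ L₂ : List (Vec Bool n)} → T (u ∨ v) →
  (T u → NonEmpty L₁) → (T v → NonEmpty L₂) → NonEmpty (L₁ ++ L₂)
nonEmpty-++ u∨v ne₁ ne₂ =
  [ (λ u → let w , w∈ = ne₁ u in w , ∈-++⁺ˡ w∈)
  , (λ v → let w , w∈ = ne₂ v in w , ∈-++⁺ʳ _ w∈)
  ] (Equivalence.to T-∨ u∨v)

nonEmpty-if : ∀ {b} → T b → NonEmpty (if b then [] ∷ [] else [])
nonEmpty-if {true} _ = _ , here refl

-- reach n s ! s' records whether W_{n-1}^{s,s'} is nonempty.

Reach : Set
Reach = Bool × Bool × Bool

_!_ : Reach → Box → Bool
(x , _ , _) ! bb = x
(_ , y , _) ! ab = y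
(_ , _ , z) ! ba = z

only : Box → Reach
only s = does (s ≟B bb) , does (s ≟B ab) , does (s ≟B ba)

reachStep : (e p q : Bool) → Reach → Reach
reachStep e p q (x , y , z) =
  (if e then y ∨ z else x) , (if p then y else z ∨ x) , (if q then z else y ∨ x)

module _ (f : ℕ) (X : ℤ → Symbol) where

  reach : ℕ → Box → Reach
  reach zero s = only s
  reach (suc n) s =
    reachStep (X (+ n - + 1) == X (+ n - + 1 + + f)) (X (+ n) == X (+ n - + 1))
              (X (+ n + + f) == X (+ n - + 1 + + f)) (reach n s)

  reach-sound : ∀ n s s' → T (reach n s ! s') → NonEmpty (W f X n s s')
  reach-sound zero s bb h = nonEmpty-if h
  reach-sound zero s ab h = nonEmpty-if h
  reach-sound zero s ba h = nonEmpty-if h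
  reach-sound (suc n) s bb h with X (+ n - + 1) == X (+ n - + 1 + + f)
  ... | true = nonEmpty-map (nonEmpty-++ h (reach-sound n s ab) (reach-sound n s ba))
  ... | false = nonEmpty-map (reach-sound n s bb h)
  reach-sound (suc n) s ab h with X (+ n) == X (+ n - + 1)
  ... | true = nonEmpty-map (reach-sound n s ab h)
  ... | false = nonEmpty-map (nonEmpty-++ h (reach-sound n s ba) (reach-sound n s bb))
  reach-sound (suc n) s ba h with X (+ n + + f) == X (+ n - + 1 + + f)
  ... | true = nonEmpty-map (reach-sound n s ba h)
  ... | false = nonEmpty-map (nonEmpty-++ h (reach-sound n s ab) (reach-sound n s bb))

Pair : Set
Pair = Symbol × Symbol

-- (start pair, current pair, reach from bb, from ab, from ba, mismatch seen)
Config : Set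
Config = Pair × Pair × Reach × Reach × Reach × Bool

_≟C_ : DecidableEquality Config
_≟C_ = ≡-dec ≟P (≡-dec ≟P (≡-dec ≟R (≡-dec ≟R (≡-dec ≟R _≟Bool_))))
  where
  ≟P = ≡-dec _≟S_ _≟S_
  ≟R = ≡-dec _≟Bool_ (≡-dec _≟Bool_ _≟Bool_)

open DecMembership _≟C_ using (_∈?_)

initial : Pair → Config
initial p = p , p , only bb , only ab , only ba , false

advance : Config → Pair → Config
advance (c , (u , v) , r₁ , r₂ , r₃ , seen) (u' , v') =
  c , (u' , v') , next r₁ , next r₂ , next r₃ , seen ∨ not (u' == v')
  where
  next : Reach → Reach
  next = reachStep (u == v) (u' == u) (v' == v)

returned : Config → Bool
returned ((c₁ , c₂) , (u , v) , _) = (u == c₂) ∧ (v == c₁)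

seen : Config → Bool
seen (_ , _ , _ , _ , _ , s) = s

wins : Config → Bool
wins (_ , _ , r₁ , r₂ , r₃ , _) = r₁ ! bb ∨ r₂ ! ba ∨ r₃ ! ab

-- The automaton does not know f; at step f the current pair is the swapped start pair,
-- and then 𝒲 is nonempty if some branch wins.
closes : Config → Bool
closes c = not (returned c ∧ seen c) ∨ wins c

closes-elim : ∀ c → T (closes c) → T (returned c) → T (seen c) → T (wins c)
closes-elim c = elim (returned c) (seen c)
  where
  elim : ∀ a b {g} → T (not (a ∧ b) ∨ g) → T a → T b → T g
  elim true true g _ _ = g

letters : List Symbol
letters = A ∷ B ∷ []

letterPairs : List Pair
letterPairs = cartesianProduct letters letters

explore : ℕ → List Config → List Config
explore zero R = R
explore (suc k) R = explore k (deduplicate _≟C_ (R ++ concatMap (λ c → map (advance c) letterPairs) R))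

-- Four rounds of breadth-first search already saturate; certificate? checks this.
reachable : List Config
reachable = explore 4 (map initial letterPairs)

Closed : {S I : Set} → (S → I → S) → List I → List S → Set
Closed step inputs R = All (λ s → All (λ i → step s i ∈ R) inputs) R

module _ {S I : Set} {step : S → I → S} {inputs : List I} {R : List S}
         (closed : Closed step inputs R) where

  trajectory-∈ : (σ : ℕ → S) (ι : ℕ → I) → (∀ n → σ (suc n) ≡ step (σ n) (ι n)) →
    (∀ n → ι n ∈ inputs) → σ 0 ∈ R → ∀ n → σ n ∈ R
  trajectory-∈ σ ι σ-suc ι∈ σ₀∈ zero = σ₀∈
  trajectory-∈ σ ι σ-suc ι∈ σ₀∈ (suc n) rewrite σ-suc n =
    lookup (lookup closed (trajectory-∈ σ ι σ-suc ι∈ σ₀∈ n)) (ι∈ n)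

record Certificate (R : List Config) : Set where
  field
    initial-∈ : All (λ p → initial p ∈ R) letterPairs
    closed    : Closed advance letterPairs R
    closes-∈  : All (T ∘ closes) R

certificate? : (R : List Config) → Dec (Certificate R)
certificate? R = map′ (λ (i , c , g) → record { initial-∈ = i ; closed = c ; closes-∈ = g })
  (λ cert → let open Certificate cert in initial-∈ , closed , closes-∈)
  (all? (λ p → initial p ∈? R) letterPairs
   ×-dec all? (λ c → all? (λ p → advance c p ∈? R) letterPairs) R
   ×-dec all? (T? ∘ closes) R)

reachable-certificate : Certificate reachable
reachable-certificate = from-yes (certificate? reachable)

open Certificate reachable-certificate

letter : ∀ {x} → x ≢ O → x ≢ AB → x ∈ letters
letter {A} _ _ = here refl
letter {B} _ _ = there (here refl)
letter {AB} _ x≢AB = ⊥-elim (x≢AB refl)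
letter {O} x≢O _ = ⊥-elim (x≢O refl)

module _ (f : ℕ) (X : ℤ → Symbol) where

  pairAt : ℤ → Pair
  pairAt i = X i , X (i + + f)

  mismatchSeen : ℕ → Bool
  mismatchSeen zero = false
  mismatchSeen (suc n) = mismatchSeen n ∨ not (X (+ n) == X (+ n + + f))

  mismatchSeen-complete : ∀ {j n} → j < n → X (+ j) ≢ X (+ j + + f) → T (mismatchSeen n)
  mismatchSeen-complete {j} {suc n} j<1+n mismatch with m<1+n⇒m<n∨m≡n j<1+n
  ... | inj₁ j<n = Equivalence.from T-∨ (inj₁ (mismatchSeen-complete j<n mismatch))
  ... | inj₂ refl = Equivalence.from T-∨ (inj₂ (≢⇒not-== mismatch))

  config : ℕ → Config
  config n = pairAt -[1+ 0 ] , pairAt (+ n - + 1) ,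
             reach f X n bb , reach f X n ab , reach f X n ba , mismatchSeen n

  config-reachable : (∀ i → X i ∈ letters) → ∀ n → config n ∈ reachable
  config-reachable isLetter =
    trajectory-∈ closed config (pairAt ∘ +_) (λ _ → refl) (pairAt∈ ∘ +_)
      (lookup initial-∈ (pairAt∈ -[1+ 0 ]))
    where
    pairAt∈ : ∀ i → pairAt i ∈ letterPairs
    pairAt∈ i = ∈-cartesianProduct⁺ (isLetter i) (isLetter (i + + f))

  𝒲-nonEmpty : T (reach f X f bb ! bb ∨ reach f X f ab ! ba ∨ reach f X f ba ! ab) → NonEmpty (𝒲 f X)
  𝒲-nonEmpty h = nonEmpty-++ h (reach-sound f X f bb bb)
    (λ h' → nonEmpty-++ h' (reach-sound f X f ab ba) (reach-sound f X f ba ab))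

module _ {P : ℤ → Set} (z : ℤ) (P-+ : ∀ i → P i → P (i + z)) (P-- : ∀ i → P (i + z) → P i) where

  invariant-under-multiples : ∀ q j → P (j + q * z) → P j
  invariant-under-multiples (+ zero) j h = subst P (zero-multiple j z) h
    where
    zero-multiple : ∀ j z → j + + 0 * z ≡ j
    zero-multiple = solve-∀
  invariant-under-multiples (+ suc n) j h =
    invariant-under-multiples (+ n) j (P-- _ (subst P (suc-multiple j (+ n) z) h))
    where
    suc-multiple : ∀ j n z → j + (+ 1 + n) * z ≡ j + n * z + z
    suc-multiple = solve-∀
  invariant-under-multiples -[1+ zero ] j h = subst P (minus-one j z) (P-+ _ h)
    where
    minus-one : ∀ j z → j + (- (+ 1 + + 0)) * z + z ≡ j
    minus-one = solve-∀
  invariant-under-multiples -[1+ suc n ] j h =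
    invariant-under-multiples -[1+ n ] j (subst P (pred-multiple j (+ n) z) (P-+ _ h))
    where
    pred-multiple : ∀ j n z → j + (- (+ 1 + (+ 1 + n))) * z + z ≡ j + (- (+ 1 + n)) * z
    pred-multiple = solve-∀

module _ {f : ℕ} .{{_ : NonZero f}} {X : ℤ → Symbol} (periodic : ∀ i → X (i + + 2 * + f) ≡ X i) where

  Mismatch : ℤ → Set
  Mismatch i = X i ≢ X (i + + f)

  shift-twice : ∀ i → X (i + + f + + f) ≡ X i
  shift-twice i = trans (cong X (twice i (+ f))) (periodic i)
    where
    twice : ∀ i z → i + z + z ≡ i + + 2 * z
    twice = solve-∀

  mismatch-in-period : ∀ {i} → Mismatch i → ∃ λ j → j < f × Mismatch (+ j)
  mismatch-in-period {i} mismatch = i %ℕ f , n%ℕd<d i f ,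
    invariant-under-multiples (+ f) shift-up shift-down (i /ℕ f) (+ (i %ℕ f))
      (subst Mismatch (a≡a%ℕn+[a/ℕn]*n i f) mismatch)
    where
    shift-up : ∀ i → Mismatch i → Mismatch (i + + f)
    shift-up i m e = m (sym (trans e (shift-twice i)))
    shift-down : ∀ i → Mismatch (i + + f) → Mismatch i
    shift-down i m e = m (trans (sym e) (sym (shift-twice i)))

theoremA2p1 : (f : ℕ) → 2 ≤ f → (X : ℤ → Symbol) → IsGene f X → Degenerate X →
    (NonEmpty (𝒲 f X) ⇔ Viable f X)
theoremA2p1 f@(suc _) _ X gene degenerate = mk⇔ (λ _ (i , Xi≡O , _) → degenerate i Xi≡O) nonEmpty
  where
  open IsGene gene

  isLetter : ∀ i → X i ∈ letters
  isLetter i = letter (degenerate i) (λ Xi≡AB → degenerate (i + + 1) (condAB i Xi≡AB))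

  mismatch : ∃ λ j → j < f × Mismatch periodic (+ j)
  mismatch with nontriv
  ... | i , inj₁ Xi≡O = ⊥-elim (degenerate i Xi≡O)
  ... | i , inj₂ Xi≢Xi+f = mismatch-in-period periodic Xi≢Xi+f

  nonEmpty : Viable f X → NonEmpty (𝒲 f X)
  nonEmpty _ = 𝒲-nonEmpty f X (closes-elim (config f X f)
    (lookup closes-∈ (config-reachable f X isLetter f))
    (Equivalence.from T-∧
      (==-reflexive {X (+ f - + 1)} refl , ==-reflexive (shift-twice periodic -[1+ 0 ])))
    (let j , j<f , Xj≢Xj+f = mismatch in mismatchSeen-complete f X j<f Xj≢Xj+f))
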